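{- Define $\mathrm{fea}_{s,i},\mathrm{ds}_{s,i},\mathrm{ds}^{\mathrm{dbl}}_{s,i}$ by: $\mathrm{fea}_{2,i}=0$; $\mathrm{fea}_{s,1}=\mathrm{fea}_{s-1,1}+1$ ($s\ge3$); $\mathrm{fea}_{s,i}=\mathrm{fea}_{s,i-1}+\mathrm{fea}_{s-1,i}+1$ ($s\ge3,i\ge2$); $\mathrm{ds}_{1,i}=1$, $\mathrm{ds}_{2,i}=2$, $\mathrm{ds}^{\mathrm{dbl}}_{1,i}=2$, $\mathrm{ds}^{\mathrm{dbl}}_{2,i}=5$; $\mathrm{ds}_{s,1}=2\mathrm{ds}_{s-1,1}$, $\mathrm{ds}^{\mathrm{dbl}}_{s,1}=2(\mathrm{ds}^{\mathrm{dbl}}_{s-1,1}+1)$ ($s\ge3$); and for $s\ge3,i\ge2$: if $s=3$ or $s\ge4$ is even, $\mathrm{ds}_{s,i}=2\mathrm{ds}_{s-1,i}+\mathrm{ds}_{s-2,i}(\mathrm{ds}_{s,i-1}-2)$ and $\mathrm{ds}^{\mathrm{dbl}}_{s,i}=\mathrm{ds}^{\mathrm{dbl}}_{s,i-1}+2\mathrm{ds}^{\mathrm{dbl}}_{s-1,i}+(\mathrm{ds}^{\mathrm{dbl}}_{s-2,i}+2)\mathrm{ds}_{s,i-1}$; if $s\ge5$ is odd, $\mathrm{ds}_{s,i}=2\mathrm{ds}_{s-1,i}+2\mathrm{ds}_{s-2,i}\mathrm{fea}_{s,i-1}+\mathrm{ds}_{s-3,i}\mathrm{ds}_{s,i-1}$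 and $\mathrm{ds}^{\mathrm{dbl}}_{s,i}=\mathrm{ds}^{\mathrm{dbl}}_{s,i-1}+2\mathrm{ds}^{\mathrm{dbl}}_{s-1,i}+2(\mathrm{ds}^{\mathrm{dbl}}_{s-2,i}+2)\mathrm{fea}_{s,i-1}+(\mathrm{ds}^{\mathrm{dbl}}_{s-3,i}+2)\mathrm{ds}_{s,i-1}$. Then for all $s\ge3$, $i\ge1$: $\mathrm{fea}_{s,i}=\binom{i+s-2}{s-2}-1$; $\mathrm{ds}_{3,i}=2i+2$; $\mathrm{ds}^{\mathrm{dbl}}_{3,i}=\Theta(i^2)$; $\mathrm{ds}_{4,i},\mathrm{ds}^{\mathrm{dbl}}_{4,i}=\Theta(2^i)$; $\mathrm{ds}_{5,i},\mathrm{ds}^{\mathrm{dbl}}_{5,i}=\Theta(i2^i)$; and for $s\ge6$, $\mathrm{ds}_{s,i},\mathrm{ds}^{\mathrm{dbl}}_{s,i}\le 2^{\binom{i+O(1)}{t}}$ where $t=\lfloor(s-2)/2\rfloor$.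
   Context: Asymptotic notation is as $i\to\infty$ with $s$ fixed; hidden constants may depend on $s$. -}

module Defs where

open import Data.Nat using (ℕ; zero; suc; _+_; _*_; _∸_; _^_; _≤_)
open import Data.Bool using (Bool; true; false; if_then_else_)
open import Data.Product using (Σ; _×_)

isEven : ℕ → Bool
isEven zero = true
isEven (suc zero) = false
isEven (suc (suc n)) = isEven n

-- fea s i  (meaningful for s ≥ 2, i ≥ 1; other values are junk = 0)
fea : ℕ → ℕ → ℕ
fea zero _ = 0
fea (suc zero) _ = 0
fea (suc (suc zero)) _ = 0
fea (suc (suc (suc k))) zero = 0
fea (suc (suc (suc k))) (suc zero) = fea (suc (suc k)) 1 + 1
fea (suc (suc (suc k))) (suc (suc j)) =
  fea (suc (suc (suc k))) (suc j) + fea (suc (suc k)) (suc (suc j)) + 1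

-- ds s i  (meaningful for s ≥ 1, i ≥ 1; junk = 0 otherwise).
-- Truncated subtraction ∸ is used for  ds_{s,i-1} - 2 ; all relevant values are ≥ 2.
ds : ℕ → ℕ → ℕ
ds zero _ = 0
ds (suc zero) _ = 1
ds (suc (suc zero)) _ = 2
ds (suc (suc (suc k))) zero = 0
ds (suc (suc (suc k))) (suc zero) = 2 * ds (suc (suc k)) 1
ds (suc (suc (suc zero))) (suc (suc j)) =
  2 * ds 2 (suc (suc j)) + ds 1 (suc (suc j)) * (ds 3 (suc j) ∸ 2)
ds (suc (suc (suc (suc k)))) (suc (suc j)) =
  if isEven (suc (suc (suc (suc k))))
  then 2 * ds (suc (suc (suc k))) (suc (suc j))
         + ds (suc (suc k)) (suc (suc j)) * (ds (suc (suc (suc (suc k)))) (suc j) ∸ 2)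
  else 2 * ds (suc (suc (suc k))) (suc (suc j))
         + 2 * ds (suc (suc k)) (suc (suc j)) * fea (suc (suc (suc (suc k)))) (suc j)
         + ds (suc k) (suc (suc j)) * ds (suc (suc (suc (suc k)))) (suc j)

-- ds^dbl s i  (meaningful for s ≥ 1, i ≥ 1; junk = 0 otherwise)
dsdbl : ℕ → ℕ → ℕ
dsdbl zero _ = 0
dsdbl (suc zero) _ = 2
dsdbl (suc (suc zero)) _ = 5
dsdbl (suc (suc (suc k))) zero = 0
dsdbl (suc (suc (suc k))) (suc zero) = 2 * (dsdbl (suc (suc k)) 1 + 1)
dsdbl (suc (suc (suc zero))) (suc (suc j)) =
  dsdbl 3 (suc j) + 2 * dsdbl 2 (suc (suc j)) + (dsdbl 1 (suc (suc j)) + 2) * ds 3 (suc j)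
dsdbl (suc (suc (suc (suc k)))) (suc (suc j)) =
  if isEven (suc (suc (suc (suc k))))
  then dsdbl (suc (suc (suc (suc k)))) (suc j) + 2 * dsdbl (suc (suc (suc k))) (suc (suc j))
         + (dsdbl (suc (suc k)) (suc (suc j)) + 2) * ds (suc (suc (suc (suc k)))) (suc j)
  else dsdbl (suc (suc (suc (suc k)))) (suc j) + 2 * dsdbl (suc (suc (suc k))) (suc (suc j))
         + 2 * (dsdbl (suc (suc k)) (suc (suc j)) + 2) * fea (suc (suc (suc (suc k)))) (suc j)
         + (dsdbl (suc k) (suc (suc j)) + 2) * ds (suc (suc (suc (suc k)))) (suc j)

-- f = Θ(g) as i → ∞ : there are constants c₁ c₂ and a threshold i₀ with
-- g i ≤ c₁ * f i  and  f i ≤ c₂ * g i  for all i ≥ i₀.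
-- (Natural-number constants suffice: real positive constants can be rounded.)
BigΘ : (ℕ → ℕ) → (ℕ → ℕ) → Set
BigΘ f g = Σ ℕ λ c₁ → Σ ℕ λ c₂ → Σ ℕ λ i₀ →
  ∀ i → i₀ ≤ i → (g i ≤ c₁ * f i) × (f i ≤ c₂ * g i)

module Submission where

-- * fea_{s,i} + 1 satisfies Pascal's recurrence, so it equals C(i+s-2, s-2)
--   by induction on s and i.
-- * For s = 3 everything is explicit: ds_{3,i} = 2i+2 and
--   ds^dbl_{3,i} = 4(i-1)² + 22(i-1) + 12.
-- * For s = 4, 5 the recurrences are unrolled along i; matching upper and
--   lower bounds of the form c·2^i resp. c·i·2^i follow by induction, the
--   polynomial lower-order terms being absorbed by (i+1)^5 ≤ 512·2^i.
-- * For s ≥ 6 put t = ⌊(s-2)/2⌋, so s ∈ {2t+2, 2t+3}. By induction on t ≥ 1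
--   (with a shift K growing with t) we show: ds, ds^dbl at s = 2t+2 are at
--   most 2^C(i+K,t), and at s = 2t+3 at most 2^(C(i+K,t)+i+K) (the extra
--   factor is only needed for t = 1, where ds_{5,i} ≈ i·2^i). Each recurrence
--   is a sum of at most four products of known quantities; with Pascal's
--   rule C(n+1,t+1) = C(n,t) + C(n,t+1) every summand is bounded by a quarter
--   of 2^C(n+1,t+1) once K is large enough. For t ≥ 2 both parities then
--   satisfy the strong bound, which is the claim for s ≥ 6.

open import Defs
open import Data.Nat using (ℕ; zero; suc; _+_; _*_; _∸_; _^_; _≤_; _/_)
open import Data.Nat.Combinatorics using (_C_)
open import Data.Product using (Σ; _×_)
open import Relation.Binary.PropositionalEquality using (_≡_)

open import Data.Nat using (z≤n; s≤s; s≤s⁻¹)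
open import Data.Nat.Combinatorics using (nC1≡n; nCn≡1; nCk+nC[k+1]≡[n+1]C[k+1])
open import Data.Nat.DivMod using (m/n≡1+[m∸n]/n)
open import Data.Nat.Properties
open import Data.Nat.Tactic.RingSolver using (solve; solve-∀)
open import Data.List using (_∷_; [])
open import Data.Product using (_,_; proj₁; proj₂)
open import Data.Bool using (true; false)
open import Data.Unit using (tt)
open import Function using (_$_)
open import Relation.Binary.PropositionalEquality using (refl; sym; trans; cong; cong₂; subst; module ≡-Reasoning)

-- An inequality witnessed by an explicit remainder; combined with the ring
-- solver this turns a polynomial identity into an inequality.
≤-by : ∀ {a b} r → a + r ≡ b → a ≤ b
≤-by {a} r eq = subst (a ≤_) eq (m≤m+n a r)

+-inner : ∀ c x y → c + (x + y) ≡ x + (c + y)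
+-inner = solve-∀

pascal : ∀ n k → suc n C suc k ≡ n C k + n C suc k
pascal n k = sym (nCk+nC[k+1]≡[n+1]C[k+1] n k)

[1+n]Cn≡1+n : ∀ n → suc n C n ≡ suc n
[1+n]Cn≡1+n zero = refl
[1+n]Cn≡1+n (suc n) = begin
  suc (suc n) C suc n        ≡⟨ pascal (suc n) n ⟩
  suc n C n + suc n C suc n  ≡⟨ cong₂ _+_ ([1+n]Cn≡1+n n) (nCn≡1 (suc n)) ⟩
  suc n + 1                  ≡⟨ +-comm (suc n) 1 ⟩
  suc (suc n)                ∎
  where open ≡-Reasoning

C-pos : ∀ n m → m ≤ n → 1 ≤ n C m
C-pos n zero _ = ≤-refl
C-pos (suc n) (suc m) (s≤s m≤n) = begin
  1                    ≤⟨ C-pos n m m≤n ⟩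
  n C m                ≤⟨ m≤m+n (n C m) (n C suc m) ⟩
  n C m + n C suc m    ≡⟨ nCk+nC[k+1]≡[n+1]C[k+1] n m ⟩
  suc n C suc m        ∎
  where open ≤-Reasoning

-- For 1 ≤ m ≤ n+1, each unit added to n adds at least one to C(n, m)
-- (by Pascal's rule the increment is C(n, m-1) ≥ 1).
C-grow : ∀ m n d → 1 ≤ m → m ≤ suc n → d + n C m ≤ (n + d) C m
C-grow m n zero _ _ rewrite +-identityʳ n = ≤-refl
C-grow (suc m) n (suc d) 1≤m m≤1+n rewrite +-suc n d = begin
  suc (d + n C suc m)            ≤⟨ s≤s (C-grow (suc m) n d 1≤m m≤1+n) ⟩
  suc ((n + d) C suc m)          ≤⟨ +-monoˡ-≤ ((n + d) C suc m) (C-pos (n + d) m m≤n+d) ⟩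
  (n + d) C m + (n + d) C suc m  ≡⟨ nCk+nC[k+1]≡[n+1]C[k+1] (n + d) m ⟩
  suc (n + d) C suc m            ∎
  where
    open ≤-Reasoning
    m≤n+d : m ≤ n + d
    m≤n+d = ≤-trans (s≤s⁻¹ m≤1+n) (m≤m+n n d)

C-mono : ∀ {m n n'} d → 1 ≤ m → m ≤ suc n → n + d ≤ n' → d + n C m ≤ n' C m
C-mono {m} {n} {n'} d 1≤m m≤1+n n+d≤n' = begin
  d + n C m          ≤⟨ +-monoˡ-≤ (n C m) (m≤m+n d e) ⟩
  (d + e) + n C m    ≤⟨ C-grow m n (d + e) 1≤m m≤1+n ⟩
  (n + (d + e)) C m  ≡⟨ cong (_C m) (trans (sym (+-assoc n d e)) (m+[n∸m]≡n n+d≤n')) ⟩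
  n' C m             ∎
  where
    open ≤-Reasoning
    e = n' ∸ (n + d)

C-ge : ∀ {m n} d → 1 ≤ m → m + d ≤ n → d ≤ n C m
C-ge {m} d 1≤m m+d≤n = ≤-trans (m≤m+n d (m C m)) (C-mono d 1≤m (n≤1+n m) m+d≤n)

fea₃ : ∀ j → fea 3 (suc j) ≡ suc j
fea₃ zero = refl
fea₃ (suc j) = trans (cong (λ x → x + 0 + 1) (fea₃ j)) (solve (j ∷ []))

fea-at-1 : ∀ k → fea (3 + k) 1 ≡ suc k
fea-at-1 zero = refl
fea-at-1 (suc k) = trans (cong (_+ 1) (fea-at-1 k)) (+-comm (suc k) 1)

1+fea≡C : ∀ k j → suc (fea (3 + k) (suc j)) ≡ (j + (2 + k)) C (suc k)
1+fea≡C zero j = begin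
  suc (fea 3 (suc j))  ≡⟨ cong suc (fea₃ j) ⟩
  suc (suc j)          ≡⟨ solve (j ∷ []) ⟩
  j + 2                ≡⟨ sym (nC1≡n (j + 2)) ⟩
  (j + 2) C 1          ∎
  where open ≡-Reasoning
1+fea≡C (suc k) zero = trans (cong suc (fea-at-1 (suc k))) (sym ([1+n]Cn≡1+n (suc (suc k))))
1+fea≡C (suc k) (suc j) = begin
  suc (fea (4 + k) (suc j) + fea (3 + k) (suc (suc j)) + 1)
    ≡⟨ regroup (fea (4 + k) (suc j)) (fea (3 + k) (suc (suc j))) ⟩
  suc (fea (4 + k) (suc j)) + suc (fea (3 + k) (suc (suc j)))
    ≡⟨ cong₂ _+_ (1+fea≡C (suc k) j) (1+fea≡C k (suc j)) ⟩
  (j + (3 + k)) C (2 + k) + (suc j + (2 + k)) C (suc k)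
    ≡⟨ cong (λ x → (j + (3 + k)) C (2 + k) + x C (suc k)) (sym (+-suc j (2 + k))) ⟩
  (j + (3 + k)) C (2 + k) + (j + (3 + k)) C (suc k)
    ≡⟨ +-comm ((j + (3 + k)) C (2 + k)) _ ⟩
  (j + (3 + k)) C (suc k) + (j + (3 + k)) C (2 + k)
    ≡⟨ sym (pascal (j + (3 + k)) (suc k)) ⟩
  suc (j + (3 + k)) C (2 + k) ∎
  where
    open ≡-Reasoning
    regroup : ∀ a b → suc (a + b + 1) ≡ suc a + suc b
    regroup = solve-∀

fea-closed-form : ∀ s i → 3 ≤ s → 1 ≤ i → fea s i ≡ ((i + s ∸ 2) C (s ∸ 2)) ∸ 1
fea-closed-form (suc (suc (suc k))) (suc j) (s≤s (s≤s (s≤s _))) (s≤s _)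
  rewrite +-suc j (suc (suc k)) | sym (1+fea≡C k j) = refl

-- fea_{4,i} ≤ 4i² and fea_{5,i} ≤ 4i³: crude bounds used for s = 5.
-- (Polynomials are written as products: the ring solver does not see ℕ's _^_.)
fea₄-bound : ∀ j → fea 4 (suc j) ≤ 4 * (suc j * suc j)
fea₄-bound zero = ≤ᵇ⇒≤ _ _ tt
fea₄-bound (suc j) = begin
  fea 4 (suc j) + fea 3 (suc (suc j)) + 1
    ≤⟨ +-monoˡ-≤ 1 (+-mono-≤ (fea₄-bound j) (≤-reflexive (fea₃ (suc j)))) ⟩
  4 * (suc j * suc j) + suc (suc j) + 1
    ≤⟨ ≤-by (7 * j + 9) (solve (j ∷ [])) ⟩
  4 * (suc (suc j) * suc (suc j)) ∎
  where open ≤-Reasoning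

fea₅-bound : ∀ j → fea 5 (suc j) ≤ 4 * (suc j * suc j * suc j)
fea₅-bound zero = ≤ᵇ⇒≤ _ _ tt
fea₅-bound (suc j) = begin
  fea 5 (suc j) + fea 4 (suc (suc j)) + 1
    ≤⟨ +-monoˡ-≤ 1 (+-mono-≤ (fea₅-bound j) (fea₄-bound (suc j))) ⟩
  4 * (suc j * suc j * suc j) + 4 * (suc (suc j) * suc (suc j)) + 1
    ≤⟨ ≤-by (8 * j * j + 20 * j + 11) (solve (j ∷ [])) ⟩
  4 * (suc (suc j) * suc (suc j) * suc (suc j)) ∎
  where open ≤-Reasoning

ds₃ : ∀ j → ds 3 (suc j) ≡ 2 * suc j + 2
ds₃ zero = refl
ds₃ (suc j) rewrite ds₃ j | m+n∸n≡m (2 * suc j) 2 = solve (j ∷ [])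

dsdbl₃ : ∀ j → dsdbl 3 (suc j) ≡ 4 * j * j + 22 * j + 12
dsdbl₃ zero = refl
dsdbl₃ (suc j) rewrite dsdbl₃ j | ds₃ j = solve (j ∷ [])

double-scaled : ∀ c P → 2 * (c * P) ≡ c * (2 * P)
double-scaled = solve-∀

-- (j+1)^5 ≤ 512·2^j. It holds by computation for j ≤ 6; beyond that the
-- left side at most doubles per step, as (k+8)^5 ≤ 2(k+7)^5.
pow5≤2^ : ∀ j → suc j * suc j * suc j * suc j * suc j ≤ 512 * 2 ^ j
pow5≤2^ 0 = ≤ᵇ⇒≤ _ _ tt
pow5≤2^ 1 = ≤ᵇ⇒≤ _ _ tt
pow5≤2^ 2 = ≤ᵇ⇒≤ _ _ tt
pow5≤2^ 3 = ≤ᵇ⇒≤ _ _ tt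
pow5≤2^ 4 = ≤ᵇ⇒≤ _ _ tt
pow5≤2^ 5 = ≤ᵇ⇒≤ _ _ tt
pow5≤2^ 6 = ≤ᵇ⇒≤ _ _ tt
pow5≤2^ (suc j@(suc (suc (suc (suc (suc (suc k))))))) = begin
  (8 + k) * (8 + k) * (8 + k) * (8 + k) * (8 + k)
    ≤⟨ ≤-by (846 + 3530 * k + 1740 * k * k + 340 * k * k * k + 30 * k * k * k * k + k * k * k * k * k)
            (solve (k ∷ [])) ⟩
  2 * ((7 + k) * (7 + k) * (7 + k) * (7 + k) * (7 + k))
    ≤⟨ *-monoʳ-≤ 2 (pow5≤2^ j) ⟩
  2 * (512 * 2 ^ j)
    ≡⟨ double-scaled 512 (2 ^ j) ⟩
  512 * 2 ^ suc j ∎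
  where open ≤-Reasoning

dsdbl₃-pow5 : ∀ j → dsdbl 3 (suc (suc j)) ≤ 38 * (suc j * suc j * suc j * suc j * suc j)
dsdbl₃-pow5 j rewrite dsdbl₃ (suc j) =
  ≤-by (160 * j + 376 * j * j + 380 * j * j * j + 190 * j * j * j * j + 38 * j * j * j * j * j)
       (solve (j ∷ []))

-- s = 4, upper bound, strengthened by a linear term so that the induction
-- closes: ds_{4,i} + 4(i-1) + 16 ≤ 24·2^(i-1).
ds₄-upper-strong : ∀ j → ds 4 (suc j) + 4 * j + 16 ≤ 24 * 2 ^ j
ds₄-upper-strong zero = ≤-refl
ds₄-upper-strong (suc j) = begin
    2 * ds 3 (suc (suc j)) + 2 * (x ∸ 2) + 4 * suc j + 16
  ≤⟨ +-monoˡ-≤ 16 (+-monoˡ-≤ (4 * suc j) (+-monoʳ-≤ (2 * ds 3 (suc (suc j))) (*-monoʳ-≤ 2 (m∸n≤m x 2)))) ⟩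
    2 * ds 3 (suc (suc j)) + 2 * x + 4 * suc j + 16
  ≡⟨ cong (λ z → 2 * z + 2 * x + 4 * suc j + 16) (ds₃ (suc j)) ⟩
    2 * (2 * suc (suc j) + 2) + 2 * x + 4 * suc j + 16
  ≡⟨ regroup x j ⟩
    2 * (x + 4 * j + 16)
  ≤⟨ *-monoʳ-≤ 2 (ds₄-upper-strong j) ⟩
    2 * (24 * 2 ^ j)
  ≡⟨ double-scaled 24 (2 ^ j) ⟩
    24 * 2 ^ suc j ∎
  where
    open ≤-Reasoning
    x = ds 4 (suc j)
    regroup : ∀ x j → 2 * (2 * (2 + j) + 2) + 2 * x + 4 * (1 + j) + 16 ≡ 2 * (x + 4 * j + 16)
    regroup = solve-∀

ds₄-upper : ∀ j → ds 4 (suc j) ≤ 24 * 2 ^ j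
ds₄-upper j = ≤-trans (m≤m+n _ (4 * j)) (≤-trans (m≤m+n _ 16) (ds₄-upper-strong j))

ds₄-lower : ∀ j → 4 * 2 ^ j ≤ ds 4 (suc j)
ds₄-lower zero = ≤ᵇ⇒≤ _ _ tt
ds₄-lower (suc j) = begin
    4 * (2 * 2 ^ j)    ≡⟨ sym (double-scaled 4 (2 ^ j)) ⟩
    2 * (4 * 2 ^ j)    ≤⟨ *-monoʳ-≤ 2 (ds₄-lower j) ⟩
    2 * x              ≤⟨ *-monoʳ-≤ 2 (m≤n+m∸n x 2) ⟩
    2 * (2 + (x ∸ 2))  ≡⟨ *-distribˡ-+ 2 2 (x ∸ 2) ⟩
    4 + 2 * (x ∸ 2)    ≤⟨ +-monoˡ-≤ (2 * (x ∸ 2)) 4≤2ds₃ ⟩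
    2 * ds 3 (suc (suc j)) + 2 * (x ∸ 2) ∎
  where
    open ≤-Reasoning
    x = ds 4 (suc j)
    evaluate : ∀ j → 4 + (4 * j + 8) ≡ 2 * (2 * (2 + j) + 2)
    evaluate = solve-∀
    4≤2ds₃ : 4 ≤ 2 * ds 3 (suc (suc j))
    4≤2ds₃ = ≤-by (4 * j + 8) (trans (evaluate j) (cong (2 *_) (sym (ds₃ (suc j)))))

-- s = 4, ds^dbl: the recurrence adds 2·ds^dbl_3 = O(i²) and 7·ds_4 = O(2^i).
dsdbl₄-upper : ∀ j → dsdbl 4 (suc j) ≤ 40000 * 2 ^ j
dsdbl₄-upper zero = ≤ᵇ⇒≤ _ _ tt
dsdbl₄-upper (suc j) = begin
    dsdbl 4 (suc j) + 2 * dsdbl 3 (suc (suc j)) + 7 * ds 4 (suc j)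
  ≤⟨ +-mono-≤ (+-mono-≤ (dsdbl₄-upper j) (*-monoʳ-≤ 2 dsdbl₃-bound)) (*-monoʳ-≤ 7 (ds₄-upper j)) ⟩
    40000 * 2 ^ j + 2 * (38 * (512 * 2 ^ j)) + 7 * (24 * 2 ^ j)
  ≤⟨ ≤-by (920 * 2 ^ j) (collect (2 ^ j)) ⟩
    40000 * (2 * 2 ^ j) ∎
  where
    open ≤-Reasoning
    dsdbl₃-bound : dsdbl 3 (suc (suc j)) ≤ 38 * (512 * 2 ^ j)
    dsdbl₃-bound = ≤-trans (dsdbl₃-pow5 j) (*-monoʳ-≤ 38 (pow5≤2^ j))
    collect : ∀ P → 40000 * P + 2 * (38 * (512 * P)) + 7 * (24 * P) + 920 * P ≡ 40000 * (2 * P)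
    collect = solve-∀

-- Lower bounds for ds^dbl come from its last summand (ds^dbl_{s-2}+2)·ds_{s,i-1}.
dsdbl₄-lower : ∀ j → 7 * (4 * 2 ^ j) ≤ dsdbl 4 (suc (suc j))
dsdbl₄-lower j = ≤-trans (*-monoʳ-≤ 7 (ds₄-lower j))
  (m≤n+m (7 * ds 4 (suc j)) (dsdbl 4 (suc j) + 2 * dsdbl 3 (suc (suc j))))

-- s = 5, upper bound ds_{5,i} ≤ 12336·i·2^(i-1); the middle term
-- 2·ds_3·fea_5 of the recurrence is polynomial.
ds₅-upper : ∀ j → ds 5 (suc j) ≤ 12336 * suc j * 2 ^ j
ds₅-upper zero = ≤ᵇ⇒≤ _ _ tt
ds₅-upper (suc j) = begin
    2 * ds 4 (suc (suc j)) + 2 * ds 3 (suc (suc j)) * fea 5 (suc j) + 2 * ds 5 (suc j)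
  ≤⟨ +-mono-≤ (+-mono-≤ (*-monoʳ-≤ 2 (ds₄-upper (suc j))) polynomial-term) (*-monoʳ-≤ 2 (ds₅-upper j)) ⟩
    2 * (24 * (2 * 2 ^ j)) + 48 * (512 * 2 ^ j) + 2 * (12336 * suc j * 2 ^ j)
  ≡⟨ collect j (2 ^ j) ⟩
    12336 * suc (suc j) * (2 * 2 ^ j) ∎
  where
    open ≤-Reasoning
    quartic : ∀ j → 2 * (2 * (2 + j) + 2) * (4 * ((1 + j) * (1 + j) * (1 + j)))
                      + (80 * j + 288 * j * j + 384 * j * j * j + 224 * j * j * j * j + 48 * j * j * j * j * j)
                    ≡ 48 * ((1 + j) * (1 + j) * (1 + j) * (1 + j) * (1 + j))
    quartic = solve-∀
    collect : ∀ j P → 2 * (24 * (2 * P)) + 48 * (512 * P) + 2 * (12336 * (1 + j) * P) ≡ 12336 * (2 + j) * (2 * P)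
    collect = solve-∀
    polynomial-term : 2 * ds 3 (suc (suc j)) * fea 5 (suc j) ≤ 48 * (512 * 2 ^ j)
    polynomial-term = begin
      2 * ds 3 (suc (suc j)) * fea 5 (suc j)
        ≡⟨ cong (λ z → 2 * z * fea 5 (suc j)) (ds₃ (suc j)) ⟩
      2 * (2 * suc (suc j) + 2) * fea 5 (suc j)
        ≤⟨ *-monoʳ-≤ (2 * (2 * suc (suc j) + 2)) (fea₅-bound j) ⟩
      2 * (2 * suc (suc j) + 2) * (4 * (suc j * suc j * suc j))
        ≤⟨ ≤-by _ (quartic j) ⟩
      48 * (suc j * suc j * suc j * suc j * suc j)
        ≤⟨ *-monoʳ-≤ 48 (pow5≤2^ j) ⟩
      48 * (512 * 2 ^ j) ∎

ds₅-lower : ∀ j → suc j * 2 ^ j ≤ ds 5 (suc j)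
ds₅-lower zero = ≤ᵇ⇒≤ _ _ tt
ds₅-lower (suc j) = begin
    suc (suc j) * (2 * 2 ^ j)
  ≤⟨ ≤-by (14 * 2 ^ j) (regroup j (2 ^ j)) ⟩
    2 * (4 * (2 * 2 ^ j)) + 2 * (suc j * 2 ^ j)
  ≤⟨ +-mono-≤ (*-monoʳ-≤ 2 (ds₄-lower (suc j))) (*-monoʳ-≤ 2 (ds₅-lower j)) ⟩
    2 * ds 4 (suc (suc j)) + 2 * ds 5 (suc j)
  ≤⟨ +-monoˡ-≤ (2 * ds 5 (suc j)) (m≤m+n (2 * ds 4 (suc (suc j))) (2 * ds 3 (suc (suc j)) * fea 5 (suc j))) ⟩
    2 * ds 4 (suc (suc j)) + 2 * ds 3 (suc (suc j)) * fea 5 (suc j) + 2 * ds 5 (suc j) ∎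
  where
    open ≤-Reasoning
    regroup : ∀ j P → (2 + j) * (2 * P) + 14 * P ≡ 2 * (4 * (2 * P)) + 2 * ((1 + j) * P)
    regroup = solve-∀

dsdbl₅-upper : ∀ j → dsdbl 5 (suc j) ≤ 200000 * suc j * 2 ^ j
dsdbl₅-upper zero = ≤ᵇ⇒≤ _ _ tt
dsdbl₅-upper (suc j) = begin
    dsdbl 5 (suc j) + 2 * dsdbl 4 (suc (suc j)) + 2 * (dsdbl 3 (suc (suc j)) + 2) * fea 5 (suc j) + 7 * ds 5 (suc j)
  ≤⟨ +-mono-≤ (+-mono-≤ (+-mono-≤ (dsdbl₅-upper j) (*-monoʳ-≤ 2 (dsdbl₄-upper (suc j)))) polynomial-term)
              (*-monoʳ-≤ 7 (ds₅-upper j)) ⟩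
    200000 * suc j * 2 ^ j + 2 * (40000 * (2 * 2 ^ j)) + 320 * (512 * 2 ^ j) + 7 * (12336 * suc j * 2 ^ j)
  ≤⟨ ≤-by (113648 * suc j * 2 ^ j + 76160 * 2 ^ j) (collect j (2 ^ j)) ⟩
    200000 * suc (suc j) * (2 * 2 ^ j) ∎
  where
    open ≤-Reasoning
    quintic : ∀ j → 2 * (4 * (1 + j) * (1 + j) + 22 * (1 + j) + 12 + 2) * (4 * ((1 + j) * (1 + j) * (1 + j)))
                      + (400 * j + 1488 * j * j + 2064 * j * j * j + 1264 * j * j * j * j + 288 * j * j * j * j * j)
                    ≡ 320 * ((1 + j) * (1 + j) * (1 + j) * (1 + j) * (1 + j))
    quintic = solve-∀
    collect : ∀ j P → 200000 * (1 + j) * P + 2 * (40000 * (2 * P)) + 320 * (512 * P) + 7 * (12336 * (1 + j) * P)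
                        + (113648 * (1 + j) * P + 76160 * P)
                      ≡ 200000 * (2 + j) * (2 * P)
    collect = solve-∀
    polynomial-term : 2 * (dsdbl 3 (suc (suc j)) + 2) * fea 5 (suc j) ≤ 320 * (512 * 2 ^ j)
    polynomial-term = begin
      2 * (dsdbl 3 (suc (suc j)) + 2) * fea 5 (suc j)
        ≡⟨ cong (λ z → 2 * (z + 2) * fea 5 (suc j)) (dsdbl₃ (suc j)) ⟩
      2 * (4 * suc j * suc j + 22 * suc j + 12 + 2) * fea 5 (suc j)
        ≤⟨ *-monoʳ-≤ (2 * (4 * suc j * suc j + 22 * suc j + 12 + 2)) (fea₅-bound j) ⟩
      2 * (4 * suc j * suc j + 22 * suc j + 12 + 2) * (4 * (suc j * suc j * suc j))
        ≤⟨ ≤-by _ (quintic j) ⟩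
      320 * (suc j * suc j * suc j * suc j * suc j)
        ≤⟨ *-monoʳ-≤ 320 (pow5≤2^ j) ⟩
      320 * (512 * 2 ^ j) ∎

dsdbl₅-lower : ∀ j → 7 * (suc j * 2 ^ j) ≤ dsdbl 5 (suc (suc j))
dsdbl₅-lower j = ≤-trans (*-monoʳ-≤ 7 (ds₅-lower j))
  (m≤n+m (7 * ds 5 (suc j))
    (dsdbl 5 (suc j) + 2 * dsdbl 4 (suc (suc j)) + 2 * (dsdbl 3 (suc (suc j)) + 2) * fea 5 (suc j)))

dsdbl₃-Θ : BigΘ (dsdbl 3) (λ i → i ^ 2)
dsdbl₃-Θ = 1 , 18 , 1 , bounds
  where
    lower : ∀ j → (1 + j) * ((1 + j) * 1) + (3 * j * j + 20 * j + 11) ≡ 1 * (4 * j * j + 22 * j + 12)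
    lower = solve-∀
    upper : ∀ j → 4 * j * j + 22 * j + 12 + (14 * j * j + 14 * j + 6) ≡ 18 * ((1 + j) * ((1 + j) * 1))
    upper = solve-∀
    bounds : ∀ i → 1 ≤ i → (i ^ 2 ≤ 1 * dsdbl 3 i) × (dsdbl 3 i ≤ 18 * i ^ 2)
    bounds (suc j) _ rewrite dsdbl₃ j = ≤-by _ (lower j) , ≤-by _ (upper j)

ds₄-Θ : BigΘ (ds 4) (λ i → 2 ^ i)
ds₄-Θ = 1 , 12 , 1 , bounds
  where
    lower : ∀ P → 2 * P + 2 * P ≡ 4 * P
    lower = solve-∀
    upper : ∀ P → 24 * P ≡ 12 * (2 * P)
    upper = solve-∀
    bounds : ∀ i → 1 ≤ i → (2 ^ i ≤ 1 * ds 4 i) × (ds 4 i ≤ 12 * 2 ^ i)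
    bounds (suc j) _ =
        ≤-trans (≤-by _ (lower (2 ^ j))) (≤-trans (ds₄-lower j) (≤-reflexive (sym (*-identityˡ _))))
      , ≤-trans (ds₄-upper j) (≤-reflexive (upper (2 ^ j)))

dsdbl₄-Θ : BigΘ (dsdbl 4) (λ i → 2 ^ i)
dsdbl₄-Θ = 1 , 20000 , 2 , bounds
  where
    lower : ∀ P → 2 * (2 * P) + 24 * P ≡ 7 * (4 * P)
    lower = solve-∀
    upper : ∀ P → 40000 * (2 * P) ≡ 20000 * (2 * (2 * P))
    upper = solve-∀
    bounds : ∀ i → 2 ≤ i → (2 ^ i ≤ 1 * dsdbl 4 i) × (dsdbl 4 i ≤ 20000 * 2 ^ i)
    bounds (suc zero) (s≤s ())
    bounds (suc (suc j)) _ =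
        ≤-trans (≤-by _ (lower (2 ^ j))) (≤-trans (dsdbl₄-lower j) (≤-reflexive (sym (*-identityˡ _))))
      , ≤-trans (dsdbl₄-upper (suc j)) (≤-reflexive (upper (2 ^ j)))

ds₅-Θ : BigΘ (ds 5) (λ i → i * 2 ^ i)
ds₅-Θ = 2 , 6168 , 1 , bounds
  where
    lower : ∀ j P → (1 + j) * (2 * P) ≡ 2 * ((1 + j) * P)
    lower = solve-∀
    upper : ∀ j P → 12336 * (1 + j) * P ≡ 6168 * ((1 + j) * (2 * P))
    upper = solve-∀
    bounds : ∀ i → 1 ≤ i → (i * 2 ^ i ≤ 2 * ds 5 i) × (ds 5 i ≤ 6168 * (i * 2 ^ i))
    bounds (suc j) _ =
        ≤-trans (≤-reflexive (lower j (2 ^ j))) (*-monoʳ-≤ 2 (ds₅-lower j))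
      , ≤-trans (ds₅-upper j) (≤-reflexive (upper j (2 ^ j)))

dsdbl₅-Θ : BigΘ (dsdbl 5) (λ i → i * 2 ^ i)
dsdbl₅-Θ = 2 , 100000 , 2 , bounds
  where
    lower : ∀ j P → (2 + j) * (2 * (2 * P)) + (6 * P + 10 * j * P) ≡ 2 * (7 * ((1 + j) * P))
    lower = solve-∀
    upper : ∀ j P → 200000 * (2 + j) * (2 * P) ≡ 100000 * ((2 + j) * (2 * (2 * P)))
    upper = solve-∀
    bounds : ∀ i → 2 ≤ i → (i * 2 ^ i ≤ 2 * dsdbl 5 i) × (dsdbl 5 i ≤ 100000 * (i * 2 ^ i))
    bounds (suc zero) (s≤s ())
    bounds (suc (suc j)) _ =
        ≤-trans (≤-by _ (lower j (2 ^ j))) (*-monoʳ-≤ 2 (dsdbl₅-lower j))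
      , ≤-trans (dsdbl₅-upper (suc j)) (≤-reflexive (upper j (2 ^ j)))

1≤2^ : ∀ e → 1 ≤ 2 ^ e
1≤2^ e = m^n>0 2 e

-- (The exponents are explicit: inferring them would make Agda unfold 2^e.)
≤2^-weaken : ∀ {a} e f → a ≤ 2 ^ e → e ≤ f → a ≤ 2 ^ f
≤2^-weaken _ _ a≤ e≤f = ≤-trans a≤ (^-monoʳ-≤ 2 e≤f)

≤2^-double : ∀ {a} e → a ≤ 2 ^ e → 2 * a ≤ 2 ^ suc e
≤2^-double e a≤ = *-monoʳ-≤ 2 a≤

≤2^-+ : ∀ {a b} e → a ≤ 2 ^ e → b ≤ 2 ^ e → a + b ≤ 2 ^ suc e
≤2^-+ e a≤ b≤ = ≤-trans (+-mono-≤ a≤ b≤) (≤-reflexive (cong (2 ^ e +_) (sym (+-identityʳ (2 ^ e)))))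

≤2^-* : ∀ {a b} e f → a ≤ 2 ^ e → b ≤ 2 ^ f → a * b ≤ 2 ^ (e + f)
≤2^-* e f a≤ b≤ = ≤-trans (*-mono-≤ a≤ b≤) (≤-reflexive (sym (^-distribˡ-+-* 2 e f)))

≤2^-+2 : ∀ {a} e → a ≤ 2 ^ e → a + 2 ≤ 2 ^ (2 + e)
≤2^-+2 e a≤ = ≤-trans (+-mono-≤ a≤ (+-mono-≤ (1≤2^ e) (1≤2^ e))) (≤-by (2 ^ e) (regroup (2 ^ e)))
  where
    regroup : ∀ P → P + (P + P) + P ≡ 2 * (2 * P)
    regroup = solve-∀

1+n≤2^n : ∀ n → suc n ≤ 2 ^ n
1+n≤2^n zero = ≤-refl
1+n≤2^n (suc n) = ≤-trans (≤-reflexive (+-comm 1 (suc n))) (≤2^-+ n (1+n≤2^n n) (1≤2^ n))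

-- x takes at most a quarter of 2^B: x ≤ 2^t with 2 + t ≤ B.
Quarter : ℕ → ℕ → Set
Quarter B x = Σ ℕ λ t → (x ≤ 2 ^ t) × (2 + t ≤ B)

quarters : ∀ {B a b c d} → Quarter B a → Quarter B b → Quarter B c → Quarter B d → a + b + c + d ≤ 2 ^ B
quarters {B} {a} {b} {c} {d} (ta , a≤ , la) (_ , b≤ , lb) (_ , c≤ , lc) (_ , d≤ , ld) = begin
  a + b + c + d      ≡⟨ +-assoc (a + b) c d ⟩
  a + b + (c + d)    ≤⟨ ≤2^-+ (suc e) (≤2^-+ e (fit a≤ la) (fit b≤ lb)) (≤2^-+ e (fit c≤ lc) (fit d≤ ld)) ⟩
  2 ^ (2 + e)        ≡⟨ cong (2 ^_) (m+[n∸m]≡n (m+n≤o⇒m≤o 2 la)) ⟩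
  2 ^ B              ∎
  where
    open ≤-Reasoning
    e = B ∸ 2
    fit : ∀ {x t} → x ≤ 2 ^ t → 2 + t ≤ B → x ≤ 2 ^ e
    fit {t = t} x≤ room = ≤2^-weaken t e x≤ (∸-monoˡ-≤ 2 room)

quarter-zero : ∀ {B x} → Quarter B x → Quarter B 0
quarter-zero (t , _ , room) = t , z≤n , room

quarters₃ : ∀ {B a b c} → Quarter B a → Quarter B b → Quarter B c → a + b + c ≤ 2 ^ B
quarters₃ {B} {a} {b} {c} qa qb qc =
  subst (_≤ 2 ^ B) (+-identityʳ (a + b + c)) (quarters qa qb qc (quarter-zero qa))

quarters₂ : ∀ {B a b} → Quarter B a → Quarter B b → a + b ≤ 2 ^ B
quarters₂ {B} {a} {b} qa qb = subst (_≤ 2 ^ B) (+-identityʳ (a + b)) (quarters₃ qa qb (quarter-zero qa))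

-- At i = 1 the recurrences for s ≥ 3 read ds_{s,1} = 2·ds_{s-1,1} and
-- ds^dbl_{s,1} = 2(ds^dbl_{s-1,1} + 1).
first-index-arith : ∀ {a d} P E → a ≤ 2 ^ P → d ≤ 2 ^ P → 3 + P ≤ E
  → (2 * a ≤ 2 ^ E) × (2 * (d + 1) ≤ 2 ^ E)
first-index-arith {a} {d} P E a≤ d≤ room =
    ≤2^-weaken (suc P) E (≤2^-double P a≤) (m+n≤o⇒n≤o 2 room)
  , ≤2^-weaken (3 + P) E (≤-trans (*-monoʳ-≤ 2 (+-monoʳ-≤ d (s≤s z≤n))) (≤2^-double (2 + P) (≤2^-+2 P d≤)))
                room

-- The exponent budget of one step i → i+1 of the recurrences for s ≥ 6:
-- the previous values are ≤ 2^A, the data from s-1 are ≤ 2^P and from the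
-- even index among s-2, s-3 are ≤ 2^Q; the new values are to be bounded by
-- 2^(M+A). Under the two room conditions each of the following summands
-- takes at most a quarter of that.
module StepBudget (A M P Q : ℕ) (P-room : 3 + P ≤ M + A) (Q-room : 4 + Q ≤ M) where

  doubled : ∀ {a} → a ≤ 2 ^ P → Quarter (M + A) (2 * a)
  doubled a≤ = suc P , ≤2^-double P a≤ , P-room

  previous : ∀ {y} → y ≤ 2 ^ A → Quarter (M + A) y
  previous y≤ = A , y≤ , +-monoˡ-≤ A (m+n≤o⇒m≤o 2 Q-room)

  product : ∀ {a x} → a ≤ 2 ^ Q → x ≤ 2 ^ A → Quarter (M + A) (a * x)
  product a≤ x≤ = Q + A , ≤2^-* Q A a≤ x≤ , +-monoˡ-≤ A (m+n≤o⇒n≤o 2 Q-room)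

  shifted-product : ∀ {d x} → d ≤ 2 ^ Q → x ≤ 2 ^ A → Quarter (M + A) ((d + 2) * x)
  shifted-product d≤ x≤ = 2 + Q + A , ≤2^-* (2 + Q) A (≤2^-+2 Q d≤) x≤ , +-monoˡ-≤ A Q-room

-- One step for even s: ds_{s,i+1} = 2a₁ + a₂(x - 2) and
-- ds^dbl_{s,i+1} = y + 2d₁ + (d₂ + 2)x, with x = ds_{s,i}, y = ds^dbl_{s,i}.
even-step-arith : ∀ {x y a₁ d₁ a₂ d₂} A M P Q
  → x ≤ 2 ^ A → y ≤ 2 ^ A → a₁ ≤ 2 ^ P → d₁ ≤ 2 ^ P → a₂ ≤ 2 ^ Q → d₂ ≤ 2 ^ Q
  → 3 + P ≤ M + A → 4 + Q ≤ M
  → (2 * a₁ + a₂ * (x ∸ 2) ≤ 2 ^ (M + A)) × (y + 2 * d₁ + (d₂ + 2) * x ≤ 2 ^ (M + A))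
even-step-arith {x} A M P Q x≤ y≤ a₁≤ d₁≤ a₂≤ d₂≤ P-room Q-room =
    quarters₂ (doubled a₁≤) (product a₂≤ (≤-trans (m∸n≤m x 2) x≤))
  , quarters₃ (previous y≤) (doubled d₁≤) (shifted-product d₂≤ x≤)
  where open StepBudget A M P Q P-room Q-room

-- One step for odd s: the data from s-1, s-2, s-3 are ≤ 2^P, 2^R, 2^Q and
-- the factor f = fea_{s,i} is ≤ 2^F; the summands with f need 5 + R + F ≤ M + A.
odd-step-arith : ∀ {x y a₁ d₁ a₂ d₂ a₃ d₃ f} A M P Q R F
  → x ≤ 2 ^ A → y ≤ 2 ^ A → a₁ ≤ 2 ^ P → d₁ ≤ 2 ^ P → a₂ ≤ 2 ^ R → d₂ ≤ 2 ^ R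
  → a₃ ≤ 2 ^ Q → d₃ ≤ 2 ^ Q → f ≤ 2 ^ F
  → 3 + P ≤ M + A → 4 + Q ≤ M → 5 + R + F ≤ M + A
  → (2 * a₁ + 2 * a₂ * f + a₃ * x ≤ 2 ^ (M + A))
    × (y + 2 * d₁ + 2 * (d₂ + 2) * f + (d₃ + 2) * x ≤ 2 ^ (M + A))
odd-step-arith A M P Q R F x≤ y≤ a₁≤ d₁≤ a₂≤ d₂≤ a₃≤ d₃≤ f≤ P-room Q-room R-room =
    quarters₃ (doubled a₁≤)
              (suc R + F , ≤2^-* (suc R) F (≤2^-double R a₂≤) f≤ , m+n≤o⇒n≤o 2 R-room)
              (product a₃≤ x≤)
  , quarters (previous y≤) (doubled d₁≤)
             (3 + R + F , ≤2^-* (3 + R) F (≤2^-double (2 + R) (≤2^-+2 R d₂≤)) f≤ , R-room)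
             (shifted-product d₃≤ x≤)
  where open StepBudget A M P Q P-room Q-room

-- twice u = 2u, defined by recursion so that the parity test reduces.
twice : ℕ → ℕ
twice zero = 0
twice (suc u) = suc (suc (twice u))

-- The two values of s at level t = u + 1: s = 2t + 2 and s = 2t + 3.
evenS oddS : ℕ → ℕ
evenS u = 4 + twice u
oddS u = 5 + twice u

twice-even : ∀ u → isEven (twice u) ≡ true
twice-even zero = refl
twice-even (suc u) = twice-even u

twice-odd : ∀ u → isEven (suc (twice u)) ≡ false
twice-odd zero = refl
twice-odd (suc u) = twice-odd u

ds-even-rec : ∀ u j → ds (evenS (suc u)) (suc (suc j))
  ≡ 2 * ds (oddS u) (suc (suc j)) + ds (evenS u) (suc (suc j)) * (ds (evenS (suc u)) (suc j) ∸ 2)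
ds-even-rec u j rewrite twice-even u = refl

dsdbl-even-rec : ∀ u j → dsdbl (evenS (suc u)) (suc (suc j))
  ≡ dsdbl (evenS (suc u)) (suc j) + 2 * dsdbl (oddS u) (suc (suc j))
    + (dsdbl (evenS u) (suc (suc j)) + 2) * ds (evenS (suc u)) (suc j)
dsdbl-even-rec u j rewrite twice-even u = refl

ds-odd-rec : ∀ u j → ds (oddS (suc u)) (suc (suc j))
  ≡ 2 * ds (evenS (suc u)) (suc (suc j)) + 2 * ds (oddS u) (suc (suc j)) * fea (oddS (suc u)) (suc j)
    + ds (evenS u) (suc (suc j)) * ds (oddS (suc u)) (suc j)
ds-odd-rec u j rewrite twice-odd u = refl

dsdbl-odd-rec : ∀ u j → dsdbl (oddS (suc u)) (suc (suc j))
  ≡ dsdbl (oddS (suc u)) (suc j) + 2 * dsdbl (evenS (suc u)) (suc (suc j))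
    + 2 * (dsdbl (oddS u) (suc (suc j)) + 2) * fea (oddS (suc u)) (suc j)
    + (dsdbl (evenS u) (suc (suc j)) + 2) * ds (oddS (suc u)) (suc j)
dsdbl-odd-rec u j rewrite twice-odd u = refl

-- fea_{s,i} < 2^(i+s): a crude bound, enough for the factor fea in the odd recurrences.
1+fea≤2^ : ∀ s i → fea s i + 1 ≤ 2 ^ (i + s)
1+fea≤2^ zero i = 1≤2^ (i + 0)
1+fea≤2^ (suc zero) i = 1≤2^ (i + 1)
1+fea≤2^ (suc (suc zero)) i = 1≤2^ (i + 2)
1+fea≤2^ (suc (suc (suc k))) zero = 1≤2^ (3 + k)
1+fea≤2^ (suc (suc (suc k))) (suc zero) = ≤2^-+ (3 + k) (1+fea≤2^ (suc (suc k)) 1) (1≤2^ (3 + k))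
1+fea≤2^ s@(suc s-1@(suc (suc k))) (suc (suc j)) = begin
  fea s (suc j) + fea s-1 (suc (suc j)) + 1 + 1
    ≡⟨ regroup (fea s (suc j)) (fea s-1 (suc (suc j))) ⟩
  (fea s (suc j) + 1) + (fea s-1 (suc (suc j)) + 1)
    ≤⟨ ≤2^-+ (suc j + s) (1+fea≤2^ s (suc j))
             (subst (λ e → fea s-1 (suc (suc j)) + 1 ≤ 2 ^ e) (sym (+-suc (suc j) s-1))
                    (1+fea≤2^ s-1 (suc (suc j)))) ⟩
  2 ^ (suc (suc j) + s) ∎
  where
    open ≤-Reasoning
    regroup : ∀ a b → a + b + 1 + 1 ≡ a + 1 + (b + 1)
    regroup = solve-∀

fea≤2^ : ∀ s i → fea s i ≤ 2 ^ (i + s)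
fea≤2^ s i = ≤-trans (m≤m+n (fea s i) 1) (1+fea≤2^ s i)

-- ds_{s,i} and ds^dbl_{s,i} are at most 2^E(i-1) for all i ≥ 1.
Bounded : ℕ → (ℕ → ℕ) → Set
Bounded s E = ∀ j → (ds s (suc j) ≤ 2 ^ E j) × (dsdbl s (suc j) ≤ 2 ^ E j)

bounded-weaken : ∀ {s E E'} → (∀ j → E j ≤ E' j) → Bounded s E → Bounded s E'
bounded-weaken {E = E} {E'} E≤E' bd j =
  ≤2^-weaken (E j) (E' j) (proj₁ (bd j)) (E≤E' j) , ≤2^-weaken (E j) (E' j) (proj₂ (bd j)) (E≤E' j)

strongExp weakExp : ℕ → ℕ → ℕ → ℕ
strongExp t K j = (suc j + K) C t
weakExp t K j = (suc j + K) C t + (suc j + K)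

strong⇒weak : ∀ {s t K} → Bounded s (strongExp t K) → Bounded s (weakExp t K)
strong⇒weak {s} {t} {K} = bounded-weaken {s} λ j → m≤m+n ((suc j + K) C t) (suc j + K)

strong-shift : ∀ {s t K} d → 1 ≤ t → t ≤ K → Bounded s (strongExp t K) → Bounded s (strongExp t (K + d))
strong-shift {s} {t} {K} d 1≤t t≤K = bounded-weaken {s} λ j →
  C-mono 0 1≤t (≤-trans t≤K (≤-trans (m≤n+m K (suc j)) (n≤1+n _)))
    (≤-trans (≤-reflexive (+-identityʳ (suc j + K))) (≤-trans (m≤m+n (suc j + K) d) (≤-reflexive (+-assoc (suc j) K d))))

-- Exponent budgets of the induction on the level t ≥ 1: K ≥ t is the shift
-- of the level-t bounds, and a step goes from i = j+1 to i = j+2, where the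
-- level-t data are bounded with exponent C(L, t) (+ L), L = j+2+K.

-- At i = 1 for the even value: weak level-t exponent + 3 fits below C(K'+1, t+1), K' = K+t+5.
even-start-room : ∀ t K → 1 ≤ t → t ≤ K
  → 3 + ((1 + K) C t + (1 + K)) ≤ (1 + (K + (t + 5))) C suc t
even-start-room t K 1≤t t≤K = begin
  3 + ((1 + K) C t + (1 + K))               ≡⟨ +-inner 3 ((1 + K) C t) (1 + K) ⟩
  (1 + K) C t + (4 + K)                     ≤⟨ +-mono-≤ grow-t grow-1+t ⟩
  (K + (t + 5)) C t + (K + (t + 5)) C suc t ≡⟨ sym (pascal (K + (t + 5)) t) ⟩
  (1 + (K + (t + 5))) C suc t               ∎
  where
    open ≤-Reasoning
    shift : 1 + K + 0 + (t + 4) ≡ K + (t + 5)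
    shift = solve (K ∷ t ∷ [])
    grow-t : (1 + K) C t ≤ (K + (t + 5)) C t
    grow-t = C-mono 0 1≤t (≤-trans t≤K (≤-trans (n≤1+n K) (n≤1+n _))) (≤-by (t + 4) shift)
    exact : suc t + (4 + K) ≡ K + (t + 5)
    exact = solve (K ∷ t ∷ [])
    grow-1+t : 4 + K ≤ (K + (t + 5)) C suc t
    grow-1+t = C-ge (4 + K) (s≤s z≤n) (≤-reflexive exact)

-- Level-t data fit with four bits to spare below C(n, t), n = j+1+K', once K' ≥ K+t+5.
level-room : ∀ {t K K'} j → 1 ≤ t → t ≤ K → K + (t + 5) ≤ K' → 4 + (2 + j + K) C t ≤ (suc j + K') C t
level-room {t} {K} {K'} j 1≤t t≤K K'-big = C-mono 4 1≤t t≤1+L L+4≤n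
  where
    t≤1+L : t ≤ suc (2 + j + K)
    t≤1+L = ≤-trans t≤K (≤-trans (m≤n+m K (2 + j)) (n≤1+n _))
    exact : 2 + j + K + 4 + t ≡ suc j + (K + (t + 5))
    exact = solve (j ∷ K ∷ t ∷ [])
    L+4≤n : 2 + j + K + 4 ≤ suc j + K'
    L+4≤n = ≤-trans (≤-by t exact) (+-monoʳ-≤ (suc j) K'-big)

-- Even step, i ≥ 2: the weak level-t exponent + 3 fits below
-- C(n, t) + C(n, t+1) = C(n+1, t+1), n = j+1+K+t+5.
even-room : ∀ t K j → 1 ≤ t → t ≤ K
  → 3 + ((2 + j + K) C t + (2 + j + K))
    ≤ (suc j + (K + (t + 5))) C t + (suc j + (K + (t + 5))) C suc t
even-room t K j 1≤t t≤K =
  ≤-trans (+-monoˡ-≤ (2 + j + K) (n≤1+n (3 + (2 + j + K) C t)))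
          (+-mono-≤ (level-room j 1≤t t≤K ≤-refl) (C-ge (2 + j + K) (s≤s z≤n) (≤-by 3 exact)))
  where
    exact : suc t + (2 + j + K) + 3 ≡ suc j + (K + (t + 5))
    exact = solve (j ∷ K ∷ t ∷ [])

-- Odd step, i = 1: the new even value's exponent + 3 fits below the odd one,
-- whose shift is K+t+5 + (s+t+9).
odd-start-room : ∀ t K s
  → 3 + (1 + (K + (t + 5))) C suc t ≤ (1 + (K + (t + 5) + (s + t + 9))) C suc t
odd-start-room t K s = C-mono 3 (s≤s z≤n) (s≤s (≤-trans (m≤n+m t (K + 1)) (≤-by 5 shape))) (≤-by (s + t + 6) exact)
  where
    shape : K + 1 + t + 5 ≡ 1 + (K + (t + 5))
    shape = solve (K ∷ t ∷ [])
    exact : 1 + (K + (t + 5)) + 3 + (s + t + 6) ≡ 1 + (K + (t + 5) + (s + t + 9))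
    exact = solve (K ∷ t ∷ s ∷ [])

-- Odd step, i ≥ 2, the term from s-1: its exponent + 3 fits below C(n, t+1).
odd-room-even : ∀ t K s j → let n = suc j + (K + (t + 5) + (s + t + 9)) in
  3 + (2 + j + (K + (t + 5))) C suc t ≤ n C t + n C suc t
odd-room-even t K s j =
  ≤-trans (C-mono 3 (s≤s z≤n) (s≤s (≤-trans (m≤n+m t (2 + j + K)) (≤-by 5 shape))) (≤-by (s + t + 5) exact))
          (m≤n+m _ _)
  where
    shape : 2 + j + K + t + 5 ≡ 2 + j + (K + (t + 5))
    shape = solve (j ∷ K ∷ t ∷ [])
    exact : 2 + j + (K + (t + 5)) + 3 + (s + t + 5) ≡ suc j + (K + (t + 5) + (s + t + 9))
    exact = solve (j ∷ K ∷ t ∷ s ∷ [])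

-- Odd step, i ≥ 2, the terms with fea_{s,j+1} ≤ 2^(j+1+s): the weak level-t
-- exponent plus j+1+s plus 5 fits below C(n, t) + C(n, t+1).
odd-room-fea : ∀ t K s j → 1 ≤ t → t ≤ K → let n = suc j + (K + (t + 5) + (s + t + 9)) in
  5 + ((2 + j + K) C t + (2 + j + K)) + (suc j + s) ≤ n C t + n C suc t
odd-room-fea t K s j 1≤t t≤K = begin
  5 + ((2 + j + K) C t + (2 + j + K)) + (suc j + s)
    ≡⟨ regroup ((2 + j + K) C t) (2 + j + K) (suc j + s) ⟩
  (4 + (2 + j + K) C t) + ((2 + j + K) + (suc j + s + 1))
    ≤⟨ +-mono-≤ (level-room j 1≤t t≤K (m≤m+n _ _)) (+-mono-≤ L≤ F≤) ⟩
  n C t + ((j + K') C t + (j + K') C suc t)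
    ≡⟨ cong (n C t +_) (sym (pascal (j + K') t)) ⟩
  n C t + n C suc t ∎
  where
    open ≤-Reasoning
    K' = K + (t + 5) + (s + t + 9)
    n = suc j + K'
    regroup : ∀ Q L F → 5 + (Q + L) + F ≡ 4 + Q + (L + (F + 1))
    regroup = solve-∀
    L-exact : t + (2 + j + K) + (t + s + 12) ≡ j + (K + (t + 5) + (s + t + 9))
    L-exact = solve (j ∷ K ∷ t ∷ s ∷ [])
    L≤ : 2 + j + K ≤ (j + K') C t
    L≤ = C-ge (2 + j + K) 1≤t (≤-by (t + s + 12) L-exact)
    F-exact : suc t + (suc j + s + 1) + (K + t + 11) ≡ j + (K + (t + 5) + (s + t + 9))
    F-exact = solve (j ∷ K ∷ t ∷ s ∷ [])
    F≤ : suc j + s + 1 ≤ (j + K') C suc t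
    F≤ = C-ge (suc j + s + 1) (s≤s z≤n) (≤-by (K + t + 11) F-exact)
transport-bounds : ∀ {a b a' b' e e'} → a ≡ a' → b ≡ b' → e ≡ e'
  → (a ≤ 2 ^ e) × (b ≤ 2 ^ e) → (a' ≤ 2 ^ e') × (b' ≤ 2 ^ e')
transport-bounds refl refl refl bounds = bounds

even-step : ∀ u K → suc u ≤ K
  → Bounded (evenS u) (strongExp (suc u) K) → Bounded (oddS u) (weakExp (suc u) K)
  → Bounded (evenS (suc u)) (strongExp (suc (suc u)) (K + (suc u + 5)))
even-step u K t≤K even-bd odd-bd = go
  where
    t = suc u
    K' = K + (t + 5)
    1≤t : 1 ≤ t
    1≤t = s≤s z≤n
    go : Bounded (evenS (suc u)) (strongExp (suc t) K')
    go zero = first-index-arith (weakExp t K 0) _ (proj₁ (odd-bd 0)) (proj₂ (odd-bd 0))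
                (even-start-room t K 1≤t t≤K)
    go (suc j) =
      transport-bounds (sym (ds-even-rec u j)) (sym (dsdbl-even-rec u j)) (sym (pascal (suc j + K') t)) $
      even-step-arith ((suc j + K') C suc t) ((suc j + K') C t) (weakExp t K (suc j)) (strongExp t K (suc j))
        (proj₁ (go j)) (proj₂ (go j)) (proj₁ (odd-bd (suc j))) (proj₂ (odd-bd (suc j)))
        (proj₁ (even-bd (suc j))) (proj₂ (even-bd (suc j)))
        (even-room t K j 1≤t t≤K) (level-room j 1≤t t≤K ≤-refl)

-- From level t = u+1 and the new even value to the odd value of level t+1;
-- the shift additionally absorbs the factor fea_{s,i} ≤ 2^(i+s).
odd-step : ∀ u K → suc u ≤ K
  → Bounded (evenS u) (strongExp (suc u) K) → Bounded (oddS u) (weakExp (suc u) K)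
  → Bounded (evenS (suc u)) (strongExp (suc (suc u)) (K + (suc u + 5)))
  → Bounded (oddS (suc u)) (strongExp (suc (suc u)) (K + (suc u + 5) + (oddS (suc u) + suc u + 9)))
odd-step u K t≤K even-bd odd-bd next-even-bd = go
  where
    t = suc u
    s = oddS (suc u)
    K' = K + (t + 5) + (s + t + 9)
    1≤t : 1 ≤ t
    1≤t = s≤s z≤n
    go : Bounded s (strongExp (suc t) K')
    go zero = first-index-arith (strongExp (suc t) (K + (t + 5)) 0) _
                (proj₁ (next-even-bd 0)) (proj₂ (next-even-bd 0)) (odd-start-room t K s)
    go (suc j) =
      transport-bounds (sym (ds-odd-rec u j)) (sym (dsdbl-odd-rec u j)) (sym (pascal (suc j + K') t)) $
      odd-step-arith ((suc j + K') C suc t) ((suc j + K') C t) (strongExp (suc t) (K + (t + 5)) (suc j))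
                     (strongExp t K (suc j)) (weakExp t K (suc j)) (suc j + s)
        (proj₁ (go j)) (proj₂ (go j)) (proj₁ (next-even-bd (suc j))) (proj₂ (next-even-bd (suc j)))
        (proj₁ (odd-bd (suc j))) (proj₂ (odd-bd (suc j))) (proj₁ (even-bd (suc j))) (proj₂ (even-bd (suc j)))
        (fea≤2^ s (suc j))
        (odd-room-even t K s j) (level-room j 1≤t t≤K (m≤m+n _ _)) (odd-room-fea t K s j 1≤t t≤K)

Level : ℕ → ℕ → Set
Level u K = (suc u ≤ K) × Bounded (evenS u) (strongExp (suc u) K) × Bounded (oddS u) (weakExp (suc u) K)

StrongLevel : ℕ → ℕ → Set
StrongLevel u K = Bounded (evenS u) (strongExp (suc u) K) × Bounded (oddS u) (strongExp (suc u) K)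

-- Level 1 (s = 4, 5) from the explicit bounds: c·2^(i-1) and c·i·2^(i-1)
-- fit below 2^C(i+18, 1) and 2^(C(i+18, 1) + i + 18) for the constants at hand.
level-one-strong : ∀ {x} j c → x ≤ c * 2 ^ j → c ≤ 2 ^ 16 → x ≤ 2 ^ strongExp 1 18 j
level-one-strong {x} j c x≤ c≤ = subst (λ e → x ≤ 2 ^ e) (sym (nC1≡n (suc j + 18)))
  (≤-trans x≤ c2^j≤)
  where
    shape : 16 + j + 3 ≡ suc j + 18
    shape = solve (j ∷ [])
    c2^j≤ : c * 2 ^ j ≤ 2 ^ (suc j + 18)
    c2^j≤ = ≤2^-weaken (16 + j) (suc j + 18) (≤2^-* 16 j c≤ (≤-refl {2 ^ j})) (≤-by 3 shape)

level-one-weak : ∀ {x} j c → x ≤ c * suc j * 2 ^ j → c ≤ 2 ^ 18 → x ≤ 2 ^ weakExp 1 18 j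
level-one-weak {x} j c x≤ c≤ = subst (λ e → x ≤ 2 ^ (e + (suc j + 18))) (sym (nC1≡n (suc j + 18)))
  (≤-trans x≤ cj2^j≤)
  where
    shape : 18 + j + j + 20 ≡ suc j + 18 + (suc j + 18)
    shape = solve (j ∷ [])
    cj2^j≤ : c * suc j * 2 ^ j ≤ 2 ^ (suc j + 18 + (suc j + 18))
    cj2^j≤ = ≤2^-weaken (18 + j + j) (suc j + 18 + (suc j + 18))
               (≤2^-* (18 + j) j (≤2^-* 18 j c≤ (1+n≤2^n j)) (≤-refl {2 ^ j})) (≤-by 20 shape)

level-one : Level 0 18
level-one = ≤ᵇ⇒≤ 1 18 tt
  , (λ j → level-one-strong j 24 (ds₄-upper j) (≤ᵇ⇒≤ _ _ tt)
         , level-one-strong j 40000 (dsdbl₄-upper j) (≤ᵇ⇒≤ _ _ tt))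
  , (λ j → level-one-weak j 12336 (ds₅-upper j) (≤ᵇ⇒≤ _ _ tt)
         , level-one-weak j 200000 (dsdbl₅-upper j) (≤ᵇ⇒≤ _ _ tt))

next-level : ∀ u K → Level u K → Σ ℕ λ K' → (suc (suc u) ≤ K') × StrongLevel (suc u) K'
next-level u K (t≤K , even-bd , odd-bd) =
  Ke + X , ≤-trans 2+u≤Ke (m≤m+n Ke X) , strong-shift {evenS (suc u)} {suc (suc u)} {Ke} X (s≤s z≤n) 2+u≤Ke next-even
  , odd-step u K t≤K even-bd odd-bd next-even
  where
    Ke = K + (suc u + 5)
    X = oddS (suc u) + suc u + 9
    next-even : Bounded (evenS (suc u)) (strongExp (suc (suc u)) Ke)
    next-even = even-step u K t≤K even-bd odd-bd
    2+u≤Ke : suc (suc u) ≤ Ke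
    2+u≤Ke = ≤-trans (≤-by 4 shape) (m≤n+m (suc u + 5) K)
      where
        shape : suc (suc u) + 4 ≡ suc u + 5
        shape = solve (u ∷ [])

level : ∀ u → Σ ℕ (Level u)
level zero = 18 , level-one
level (suc u) with next-level u (proj₁ (level u)) (proj₂ (level u))
... | K' , t≤K' , even-bd , odd-bd = K' , t≤K' , even-bd , strong⇒weak {oddS (suc u)} {suc (suc u)} {K'} odd-bd

strong-level : ∀ v → Σ ℕ (StrongLevel (suc v))
strong-level v with next-level v (proj₁ (level v)) (proj₂ (level v))
... | K' , _ , bounds = K' , bounds

data Parity : ℕ → Set where
  even : ∀ v → Parity (twice v)
  odd  : ∀ v → Parity (suc (twice v))

parity : ∀ m → Parity m
parity zero = even 0
parity (suc m) with parity m
... | even v = odd v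
... | odd v = even (suc v)

half-step : ∀ n → suc (suc n) / 2 ≡ suc (n / 2)
half-step n = m/n≡1+[m∸n]/n {suc (suc n)} {2} (s≤s (s≤s z≤n))

half-twice : ∀ v → twice v / 2 ≡ v
half-twice zero = refl
half-twice (suc v) = trans (half-step (twice v)) (cong suc (half-twice v))

half-1+twice : ∀ v → suc (twice v) / 2 ≡ v
half-1+twice zero = refl
half-1+twice (suc v) = trans (half-step (suc (twice v))) (cong suc (half-1+twice v))

claim-from-bounded : ∀ {s t K} → Bounded s (strongExp t K) → (s ∸ 2) / 2 ≡ t → ∀ i → 1 ≤ i →
  (ds s i ≤ 2 ^ ((i + K) C ((s ∸ 2) / 2))) × (dsdbl s i ≤ 2 ^ ((i + K) C ((s ∸ 2) / 2)))
claim-from-bounded bounded refl (suc j) _ = bounded j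

large-s-bound : ∀ s → 6 ≤ s →
  Σ ℕ λ K → Σ ℕ λ i₀ → ∀ i → i₀ ≤ i →
    (ds s i ≤ 2 ^ ((i + K) C ((s ∸ 2) / 2))) × (dsdbl s i ≤ 2 ^ ((i + K) C ((s ∸ 2) / 2)))
large-s-bound _ (s≤s (s≤s (s≤s (s≤s (s≤s (s≤s {_} {m} _)))))) with parity m
... | even v = proj₁ (strong-level v) , 1
             , claim-from-bounded {evenS (suc v)} (proj₁ (proj₂ (strong-level v))) (half-twice (2 + v))
... | odd v = proj₁ (strong-level v) , 1
            , claim-from-bounded {oddS (suc v)} (proj₂ (proj₂ (strong-level v))) (half-1+twice (2 + v))

lemma7p7 : (∀ s i → 3 ≤ s → 1 ≤ i → fea s i ≡ ((i + s ∸ 2) C (s ∸ 2)) ∸ 1)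
    × (∀ i → 1 ≤ i → ds 3 i ≡ 2 * i + 2)
    × BigΘ (dsdbl 3) (λ i → i ^ 2)
    × BigΘ (ds 4) (λ i → 2 ^ i)
    × BigΘ (dsdbl 4) (λ i → 2 ^ i)
    × BigΘ (ds 5) (λ i → i * 2 ^ i)
    × BigΘ (dsdbl 5) (λ i → i * 2 ^ i)
    × (∀ s → 6 ≤ s →
         Σ ℕ λ K → Σ ℕ λ i₀ → ∀ i → i₀ ≤ i →
           (ds s i ≤ 2 ^ ((i + K) C ((s ∸ 2) / 2)))
           × (dsdbl s i ≤ 2 ^ ((i + K) C ((s ∸ 2) / 2))))
lemma7p7 =
    fea-closed-form
  , (λ { (suc j) _ → ds₃ j })
  , dsdbl₃-Θ , ds₄-Θ , dsdbl₄-Θ , ds₅-Θ , dsdbl₅-Θ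
  , large-s-bound
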